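{- A sequent is derivable in ${\bf G3[mic]}^=$ if and only if it is derivable in ${{\bf G3[mic]}^=}^-$.
   Context: ${\bf G3[mic]}^=$ denotes any of the multisuccedent $\mathbf{G3}$-style sequent calculi (without structural rules) for minimal, intuitionistic or classical first-order logic over a language with function symbols and equality, in the style of Negri–von Plato: sequents $\Gamma\Rightarrow\Delta$ have finite multisets of formulas on both sides, with the usual initial sequents and logical rules, extended by the equality rules $\hbox{Ref}$: from $t=t,\Gamma\Rightarrow\Delta$ infer $\Gamma\Rightarrow\Delta$ (for any term $t$), and $\hbox{Repl}$: from $s=r, P[v/s], P[v/r],\Gamma\Rightarrow\Delta$ infer $s=r,P[v/s],\Gamma\Rightarrow\Delta$, where $P$ is atomic, $s,r$ are terms and the variable $v$ does not occur in $s,r$. ${{\bf G3[mic]}^=}^-$ is obtained from ${\bf G3[mic]}^=$ by replacing $\hbox{Repl}$ with $\hbox{Repl}^-$: from $s=r, P[v/r],\Gamma\Rightarrow\Delta$ infer $s=r,P[v/s],\Gamma\Rightarrow\Delta$ (same provisos). The statement holds for each of the three logics (minimal, intuitionistic, classical), comparing the two calculi for the same logic. $P[v/t]$ denotes substitution of the term $t$ for $v$ in $P$. -}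

module Defs where

open import Data.Nat using (ℕ; zero; suc)
open import Data.Vec using (Vec; []; _∷_)
open import Data.List using (List; []; _∷_; map)
open import Data.List.Relation.Binary.Permutation.Propositional using (_↭_)
open import Relation.Binary.PropositionalEquality using (_≡_)

record Signature : Set₁ where
  field
    FunSym    : Set
    funArity  : FunSym → ℕ
    PredSym   : Set
    predArity : PredSym → ℕ

module Syntax (Σ : Signature) where
  open Signature Σ

  -- Terms; variables are de Bruijn indices (bound and free alike).
  data Term : Set where
    var : ℕ → Term
    fn  : (f : FunSym) → Vec Term (funArity f) → Term

  -- Formulas of first-order logic with equality (¬A abbreviates A ⊃ ⊥).
  data Formula : Set where
    pred : (p : PredSym) → Vec Term (predArity p) → Formula
    _≐_  : Term → Term → Formula
    ⊥'   : Formula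
    _∧'_ _∨'_ _⊃_ : Formula → Formula → Formula
    ∀' ∃' : Formula → Formula      -- binds de Bruijn index 0

  infix 8 _≐_

  data IsAtom : Formula → Set where
    atPred : ∀ p ts → IsAtom (pred p ts)
    atEq   : ∀ s t → IsAtom (s ≐ t)

  Subst : Set
  Subst = ℕ → Term

  mutual
    subT : Subst → Term → Term
    subT σ (var x)   = σ x
    subT σ (fn f ts) = fn f (subTs σ ts)

    subTs : ∀ {n} → Subst → Vec Term n → Vec Term n
    subTs σ []       = []
    subTs σ (t ∷ ts) = subT σ t ∷ subTs σ ts

  shiftT : Term → Term
  shiftT = subT (λ i → var (suc i))

  exts : Subst → Subst
  exts σ zero    = var zero
  exts σ (suc i) = shiftT (σ i)

  sub : Subst → Formula → Formula
  sub σ (pred p ts) = pred p (subTs σ ts)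
  sub σ (s ≐ t)     = subT σ s ≐ subT σ t
  sub σ ⊥'          = ⊥'
  sub σ (A ∧' B)    = sub σ A ∧' sub σ B
  sub σ (A ∨' B)    = sub σ A ∨' sub σ B
  sub σ (A ⊃ B)     = sub σ A ⊃ sub σ B
  sub σ (∀' A)      = ∀' (sub (exts σ) A)
  sub σ (∃' A)      = ∃' (sub (exts σ) A)

  -- Weakening of the variable context (all free variables shifted up by one),
  -- so that index 0 is a fresh (eigen)variable.
  shift : Formula → Formula
  shift = sub (λ i → var (suc i))

  -- Instantiation of index 0: A[0 := t], i.e. A(t/x) for A under a binder,
  -- or P[v/t] for an atom P whose distinguished variable v is index 0.
  inst : Formula → Term → Formula
  inst A t = sub (λ { zero → t ; (suc i) → var i }) A

  data Logic : Set where
    minimal intuitionistic classical : Logic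

  -- Which equality-replacement rule is used: Repl (full) or Repl⁻ (minus).
  data ReplVariant : Set where
    full minus : ReplVariant

  data HasL⊥ : Logic → Set where
    int : HasL⊥ intuitionistic
    cla : HasL⊥ classical

  data NonClassical : Logic → Set where
    min : NonClassical minimal
    int : NonClassical intuitionistic

  -- Sequents Γ ⇒ Δ with multisets represented as lists modulo permutation
  -- (the rule `perm` only implements the multiset reading; it is not a
  -- genuine structural rule).
  infix 4 G3[_,_]_⇒_
  data G3[_,_]_⇒_ (L : Logic) (V : ReplVariant) : List Formula → List Formula → Set where
    perm : ∀ {Γ Γ' Δ Δ'} → Γ ↭ Γ' → Δ ↭ Δ' → G3[ L , V ] Γ ⇒ Δ → G3[ L , V ] Γ' ⇒ Δ'
    -- initial sequents P, Γ ⇒ Δ, P  (P atomic; ⊥ counts as atom, relevant for minimal logic)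
    ax    : ∀ {P Γ Δ} → IsAtom P → G3[ L , V ] P ∷ Γ ⇒ P ∷ Δ
    ax⊥   : ∀ {Γ Δ} → G3[ L , V ] ⊥' ∷ Γ ⇒ ⊥' ∷ Δ
    L⊥    : ∀ {Γ Δ} → HasL⊥ L → G3[ L , V ] ⊥' ∷ Γ ⇒ Δ
    L∧    : ∀ {A B Γ Δ} → G3[ L , V ] A ∷ B ∷ Γ ⇒ Δ → G3[ L , V ] (A ∧' B) ∷ Γ ⇒ Δ
    R∧    : ∀ {A B Γ Δ} → G3[ L , V ] Γ ⇒ A ∷ Δ → G3[ L , V ] Γ ⇒ B ∷ Δ
          → G3[ L , V ] Γ ⇒ (A ∧' B) ∷ Δ
    L∨    : ∀ {A B Γ Δ} → G3[ L , V ] A ∷ Γ ⇒ Δ → G3[ L , V ] B ∷ Γ ⇒ Δ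
          → G3[ L , V ] (A ∨' B) ∷ Γ ⇒ Δ
    R∨    : ∀ {A B Γ Δ} → G3[ L , V ] Γ ⇒ A ∷ B ∷ Δ → G3[ L , V ] Γ ⇒ (A ∨' B) ∷ Δ
    L⊃c   : ∀ {A B Γ Δ} → L ≡ classical → G3[ L , V ] Γ ⇒ A ∷ Δ → G3[ L , V ] B ∷ Γ ⇒ Δ
          → G3[ L , V ] (A ⊃ B) ∷ Γ ⇒ Δ
    R⊃c   : ∀ {A B Γ Δ} → L ≡ classical → G3[ L , V ] A ∷ Γ ⇒ B ∷ Δ → G3[ L , V ] Γ ⇒ (A ⊃ B) ∷ Δ
    L⊃i   : ∀ {A B Γ Δ} → NonClassical L → G3[ L , V ] (A ⊃ B) ∷ Γ ⇒ A ∷ Δ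
          → G3[ L , V ] B ∷ Γ ⇒ Δ → G3[ L , V ] (A ⊃ B) ∷ Γ ⇒ Δ
    R⊃i   : ∀ {A B Γ Δ} → NonClassical L → G3[ L , V ] A ∷ Γ ⇒ B ∷ []
          → G3[ L , V ] Γ ⇒ (A ⊃ B) ∷ Δ
    -- quantifiers (the eigenvariable is the fresh index 0 after shifting)
    L∀    : ∀ {A Γ Δ} (t : Term) → G3[ L , V ] inst A t ∷ ∀' A ∷ Γ ⇒ Δ
          → G3[ L , V ] ∀' A ∷ Γ ⇒ Δ
    R∀c   : ∀ {A Γ Δ} → L ≡ classical → G3[ L , V ] map shift Γ ⇒ A ∷ map shift Δ
          → G3[ L , V ] Γ ⇒ ∀' A ∷ Δ
    R∀i   : ∀ {A Γ Δ} → NonClassical L → G3[ L , V ] map shift Γ ⇒ A ∷ []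
          → G3[ L , V ] Γ ⇒ ∀' A ∷ Δ
    L∃    : ∀ {A Γ Δ} → G3[ L , V ] A ∷ map shift Γ ⇒ map shift Δ
          → G3[ L , V ] ∃' A ∷ Γ ⇒ Δ
    R∃    : ∀ {A Γ Δ} (t : Term) → G3[ L , V ] Γ ⇒ inst A t ∷ ∃' A ∷ Δ
          → G3[ L , V ] Γ ⇒ ∃' A ∷ Δ
    Ref   : ∀ {Γ Δ} (t : Term) → G3[ L , V ] (t ≐ t) ∷ Γ ⇒ Δ → G3[ L , V ] Γ ⇒ Δ
    -- P is an atom in which index 0 plays the role of the variable v
    -- (so v does not occur in s, r); inst P s = P[v/s].
    Repl  : ∀ {s r P Γ Δ} → V ≡ full → IsAtom P
          → G3[ L , V ] (s ≐ r) ∷ inst P s ∷ inst P r ∷ Γ ⇒ Δ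
          → G3[ L , V ] (s ≐ r) ∷ inst P s ∷ Γ ⇒ Δ
    Repl⁻ : ∀ {s r P Γ Δ} → V ≡ minus → IsAtom P
          → G3[ L , V ] (s ≐ r) ∷ inst P r ∷ Γ ⇒ Δ
          → G3[ L , V ] (s ≐ r) ∷ inst P s ∷ Γ ⇒ Δ

-- Repl⁻ → Repl is easy: Repl⁻ is Repl applied after a left weakening, and
-- left weakening is admissible.  Repl → Repl⁻ is the real content: Repl⁻
-- consumes the atom P[v/s] while Repl keeps it, and atoms cannot simply be
-- duplicated in G3⁼⁻.  We therefore simulate a G3⁼ derivation by a G3⁼⁻
-- derivation of a *reduct* of its sequent, in which some atoms of the
-- antecedent are omitted because they are atomic consequences of the atoms
-- still present (consequences under Ref/Repl, see AtomCons).  A Repl step of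
-- the original merely records P[v/r] as such an omitted atom; only at an
-- initial sequent is the needed atom rebuilt inside G3⁼⁻, by Ref and Repl⁻
-- steps that consume at most one predicate atom and never lose an equation
-- (equations can be duplicated with Ref and Repl⁻: dupEq).

module Submission where

open import Defs
open import Data.List using (List)
open import Function.Bundles using (_⇔_)

open import Data.Nat using (zero; suc)
open import Data.Vec using (Vec; []; _∷_)
open import Data.List using ([]; _∷_; _++_; map)
open import Data.List.Properties using (map-++)
open import Data.List.Membership.Propositional using (_∈_)
open import Data.List.Membership.Propositional.Properties using (∈-∃++; ∈-map⁺; ∈-++⁺ʳ)
open import Data.List.Relation.Unary.Any using (here; there)
open import Data.List.Relation.Binary.Permutation.Propositional
  using (_↭_; prep; swap; ↭-sym) renaming (refl to ↭-refl; trans to ↭-trans)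
open import Data.List.Relation.Binary.Permutation.Propositional.Properties
  using (∈-resp-↭; ++⁺ʳ; ∷↭∷ʳ) renaming (shift to ↭-shift)
open import Data.Product using (∃; _×_; _,_)
open import Data.Empty using (⊥-elim)
open import Relation.Nullary using (¬_)
open import Relation.Binary.PropositionalEquality as ≡
  using (_≡_; cong; cong₂; sym; subst)
open import Function.Bundles using (mk⇔)

extract : ∀ {A : Set} {x : A} {Ξ} → x ∈ Ξ → ∃ λ Ξ₀ → Ξ ↭ x ∷ Ξ₀
extract {x = x} m with ∈-∃++ m
... | ys , zs , ≡.refl = ys ++ zs , ↭-shift x ys zs

module Proof (Sg : Signature) where
  open Syntax Sg

  mutual
    subT-cong : ∀ {σ τ : Subst} → (∀ i → σ i ≡ τ i) → ∀ t → subT σ t ≡ subT τ t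
    subT-cong h (var x)   = h x
    subT-cong h (fn f ts) = cong (fn f) (subTs-cong h ts)

    subTs-cong : ∀ {n} {σ τ : Subst} → (∀ i → σ i ≡ τ i) →
                 (ts : Vec Term n) → subTs σ ts ≡ subTs τ ts
    subTs-cong h []       = ≡.refl
    subTs-cong h (t ∷ ts) = cong₂ _∷_ (subT-cong h t) (subTs-cong h ts)

  mutual
    subT-comp : ∀ (σ τ : Subst) t → subT σ (subT τ t) ≡ subT (λ i → subT σ (τ i)) t
    subT-comp σ τ (var x)   = ≡.refl
    subT-comp σ τ (fn f ts) = cong (fn f) (subTs-comp σ τ ts)

    subTs-comp : ∀ {n} (σ τ : Subst) (ts : Vec Term n) →
                 subTs σ (subTs τ ts) ≡ subTs (λ i → subT σ (τ i)) ts
    subTs-comp σ τ []       = ≡.refl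
    subTs-comp σ τ (t ∷ ts) = cong₂ _∷_ (subT-comp σ τ t) (subTs-comp σ τ ts)

  mutual
    subT-id : ∀ t → subT var t ≡ t
    subT-id (var x)   = ≡.refl
    subT-id (fn f ts) = cong (fn f) (subTs-id ts)

    subTs-id : ∀ {n} (ts : Vec Term n) → subTs var ts ≡ ts
    subTs-id []       = ≡.refl
    subTs-id (t ∷ ts) = cong₂ _∷_ (subT-id t) (subTs-id ts)

  subT-square : ∀ {σ τ σ' τ' : Subst} → (∀ i → subT σ (τ i) ≡ subT σ' (τ' i)) →
                ∀ t → subT σ (subT τ t) ≡ subT σ' (subT τ' t)
  subT-square {σ} {τ} {σ'} {τ'} h t =
    ≡.trans (subT-comp σ τ t) (≡.trans (subT-cong h t) (sym (subT-comp σ' τ' t)))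

  subTs-square : ∀ {n} {σ τ σ' τ' : Subst} → (∀ i → subT σ (τ i) ≡ subT σ' (τ' i)) →
                 (ts : Vec Term n) → subTs σ (subTs τ ts) ≡ subTs σ' (subTs τ' ts)
  subTs-square {_} {σ} {τ} {σ'} {τ'} h ts =
    ≡.trans (subTs-comp σ τ ts) (≡.trans (subTs-cong h ts) (sym (subTs-comp σ' τ' ts)))

  up : Subst
  up i = var (suc i)

  -- The substitution performed by `inst _ t`, read off from `inst` itself so
  -- that `instSub t i` is definitionally the entry that `inst` uses.
  instSub : Term → Subst
  instSub t i = lhs (inst (var i ≐ var i) t)
    where
      lhs : Formula → Term
      lhs (u ≐ _) = u
      lhs _       = var zero

  inst-shiftT : ∀ t u → subT (instSub t) (shiftT u) ≡ u
  inst-shiftT t u = ≡.trans (subT-comp (instSub t) up u) (subT-id u)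

  shift-inst-square : ∀ t i → subT up (instSub t i) ≡ subT (instSub (shiftT t)) (exts up i)
  shift-inst-square t zero    = ≡.refl
  shift-inst-square t (suc i) = ≡.refl

  shift-inst≐ : ∀ t a b →
    shift (inst (a ≐ b) t) ≡ inst (subT (exts up) a ≐ subT (exts up) b) (shiftT t)
  shift-inst≐ t a b = cong₂ _≐_ (subT-square (shift-inst-square t) a)
                                (subT-square (shift-inst-square t) b)

  shift-instPred : ∀ t p ts →
    shift (inst (pred p ts) t) ≡ inst (pred p (subTs (exts up) ts)) (shiftT t)
  shift-instPred t p ts = cong (pred p) (subTs-square (shift-inst-square t) ts)

  inst-atom : ∀ {P t} → IsAtom P → IsAtom (inst P t)
  inst-atom (atPred p ts) = atPred p _
  inst-atom (atEq a b)    = atEq _ _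

  map-shift-++ : ∀ Γ Ξ → map shift Γ ++ map shift Ξ ≡ map shift (Γ ++ Ξ)
  map-shift-++ Γ Ξ = sym (map-++ shift Γ Ξ)

  -- All
  -- rules act at the front of the antecedent, so the extra formulas are
  -- simply carried along (shifted under the eigenvariable rules).
  weaken++ : ∀ {L V Γ Δ} → G3[ L , V ] Γ ⇒ Δ → ∀ Ξ → G3[ L , V ] Γ ++ Ξ ⇒ Δ
  weaken++ (perm p q d) Ξ = perm (++⁺ʳ Ξ p) q (weaken++ d Ξ)
  weaken++ (ax a)       Ξ = ax a
  weaken++ ax⊥          Ξ = ax⊥
  weaken++ (L⊥ h)       Ξ = L⊥ h
  weaken++ (L∧ d)       Ξ = L∧ (weaken++ d Ξ)
  weaken++ (R∧ d e)     Ξ = R∧ (weaken++ d Ξ) (weaken++ e Ξ)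
  weaken++ (L∨ d e)     Ξ = L∨ (weaken++ d Ξ) (weaken++ e Ξ)
  weaken++ (R∨ d)       Ξ = R∨ (weaken++ d Ξ)
  weaken++ (L⊃c c d e)  Ξ = L⊃c c (weaken++ d Ξ) (weaken++ e Ξ)
  weaken++ (R⊃c c d)    Ξ = R⊃c c (weaken++ d Ξ)
  weaken++ (L⊃i c d e)  Ξ = L⊃i c (weaken++ d Ξ) (weaken++ e Ξ)
  weaken++ (R⊃i c d)    Ξ = R⊃i c (weaken++ d Ξ)
  weaken++ (L∀ t d)     Ξ = L∀ t (weaken++ d Ξ)
  weaken++ {L} {V} (R∀c {A} {Γ} {Δ} c d) Ξ =
    R∀c c (subst (λ Θ → G3[ L , V ] Θ ⇒ A ∷ map shift Δ) (map-shift-++ Γ Ξ)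
                 (weaken++ d (map shift Ξ)))
  weaken++ {L} {V} (R∀i {A} {Γ} c d) Ξ =
    R∀i c (subst (λ Θ → G3[ L , V ] Θ ⇒ A ∷ []) (map-shift-++ Γ Ξ)
                 (weaken++ d (map shift Ξ)))
  weaken++ {L} {V} (L∃ {A} {Γ} {Δ} d) Ξ =
    L∃ (subst (λ Θ → G3[ L , V ] A ∷ Θ ⇒ map shift Δ) (map-shift-++ Γ Ξ)
              (weaken++ d (map shift Ξ)))
  weaken++ (R∃ t d)     Ξ = R∃ t (weaken++ d Ξ)
  weaken++ (Ref t d)    Ξ = Ref t (weaken++ d Ξ)
  weaken++ (Repl v a d) Ξ = Repl v a (weaken++ d Ξ)
  weaken++ (Repl⁻ v a d) Ξ = Repl⁻ v a (weaken++ d Ξ)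

  weaken : ∀ {L V Γ Δ} → G3[ L , V ] Γ ⇒ Δ → ∀ A → G3[ L , V ] A ∷ Γ ⇒ Δ
  weaken {Γ = Γ} d A = perm (↭-sym (∷↭∷ʳ A Γ)) ↭-refl (weaken++ d (A ∷ []))

  -- Repl⁻ is Repl after weakening in P[v/s].
  minus⇒full : ∀ {L Γ Δ} → G3[ L , minus ] Γ ⇒ Δ → G3[ L , full ] Γ ⇒ Δ
  minus⇒full (perm p q d) = perm p q (minus⇒full d)
  minus⇒full (ax a)       = ax a
  minus⇒full ax⊥          = ax⊥
  minus⇒full (L⊥ h)       = L⊥ h
  minus⇒full (L∧ d)       = L∧ (minus⇒full d)
  minus⇒full (R∧ d e)     = R∧ (minus⇒full d) (minus⇒full e)
  minus⇒full (L∨ d e)     = L∨ (minus⇒full d) (minus⇒full e)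
  minus⇒full (R∨ d)       = R∨ (minus⇒full d)
  minus⇒full (L⊃c c d e)  = L⊃c c (minus⇒full d) (minus⇒full e)
  minus⇒full (R⊃c c d)    = R⊃c c (minus⇒full d)
  minus⇒full (L⊃i c d e)  = L⊃i c (minus⇒full d) (minus⇒full e)
  minus⇒full (R⊃i c d)    = R⊃i c (minus⇒full d)
  minus⇒full (L∀ t d)     = L∀ t (minus⇒full d)
  minus⇒full (R∀c c d)    = R∀c c (minus⇒full d)
  minus⇒full (R∀i c d)    = R∀i c (minus⇒full d)
  minus⇒full (L∃ d)       = L∃ (minus⇒full d)
  minus⇒full (R∃ t d)     = R∃ t (minus⇒full d)
  minus⇒full (Ref t d)    = Ref t (minus⇒full d)
  minus⇒full (Repl () a d)
  minus⇒full (Repl⁻ {s} {P = P} _ a d) =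
    Repl ≡.refl a (perm (swap _ _ ↭-refl) ↭-refl (weaken (minus⇒full d) (inst P s)))

  Eqs⊆ : List Formula → List Formula → Set
  Eqs⊆ Θ Ξ = ∀ {a b} → (a ≐ b) ∈ Θ → (a ≐ b) ∈ Ξ

  Atoms⊆ : List Formula → List Formula → Set
  Atoms⊆ Θ Ξ = ∀ {A} → IsAtom A → A ∈ Θ → A ∈ Ξ

  atoms⇒eqs : ∀ {Θ Ξ} → Atoms⊆ Θ Ξ → Eqs⊆ Θ Ξ
  atoms⇒eqs h = h (atEq _ _)

  atoms-extend : ∀ {A Ξ} → Atoms⊆ Ξ (A ∷ Ξ)
  atoms-extend _ = there

  atoms-drop : ∀ {C Ξ} Ξ₀ → ¬ IsAtom C → Atoms⊆ (C ∷ Ξ) (Ξ₀ ++ Ξ)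
  atoms-drop Ξ₀ n a (here ≡.refl) = ⊥-elim (n a)
  atoms-drop Ξ₀ n a (there m)     = ∈-++⁺ʳ Ξ₀ m

  atoms-perm : ∀ {Θ Θ'} → Θ ↭ Θ' → Atoms⊆ Θ Θ'
  atoms-perm p _ = ∈-resp-↭ p

  eqs-drop-pred : ∀ {Ξ Ξ₀ p ts} → Ξ ↭ pred p ts ∷ Ξ₀ → Eqs⊆ Ξ Ξ₀
  eqs-drop-pred Ξ↭ m with ∈-resp-↭ Ξ↭ m
  ... | there m' = m'

  data EqCons (Θ : List Formula) : Formula → Set where
    eq-hyp  : ∀ {a b} → (a ≐ b) ∈ Θ → EqCons Θ (a ≐ b)
    eq-refl : ∀ t → EqCons Θ (t ≐ t)
    eq-repl : ∀ {s r a b} → EqCons Θ (s ≐ r) → EqCons Θ (inst (a ≐ b) s)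
            → EqCons Θ (inst (a ≐ b) r)

  -- AtomCons Θ A: the atom A follows from the atoms of Θ by Ref and Repl.
  -- A predicate atom is obtained from one predicate atom of Θ by rewriting.
  data AtomCons (Θ : List Formula) : Formula → Set where
    at-eq   : ∀ {a b} → EqCons Θ (a ≐ b) → AtomCons Θ (a ≐ b)
    at-hyp  : ∀ {p ts} → pred p ts ∈ Θ → AtomCons Θ (pred p ts)
    at-repl : ∀ {s r p ts} → EqCons Θ (s ≐ r) → AtomCons Θ (inst (pred p ts) s)
            → AtomCons Θ (inst (pred p ts) r)

  atomCons-eq : ∀ {Θ a b} → AtomCons Θ (a ≐ b) → EqCons Θ (a ≐ b)
  atomCons-eq (at-eq e) = e

  atomCons-hyp : ∀ {Θ A} → IsAtom A → A ∈ Θ → AtomCons Θ A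
  atomCons-hyp (atPred p ts) m = at-hyp m
  atomCons-hyp (atEq a b)    m = at-eq (eq-hyp m)

  atomCons-repl : ∀ {Θ P s r} → IsAtom P → AtomCons Θ (s ≐ r) → AtomCons Θ (inst P s)
                → AtomCons Θ (inst P r)
  atomCons-repl {s = s} {r} (atPred p ts) e c =
    at-repl {s = s} {r} {p} {ts} (atomCons-eq e) c
  atomCons-repl {s = s} {r} (atEq a b)    e c =
    at-eq (eq-repl {s = s} {r} {a} {b} (atomCons-eq e) (atomCons-eq c))

  eqCons-mono : ∀ {Θ Θ' A} → Eqs⊆ Θ Θ' → EqCons Θ A → EqCons Θ' A
  eqCons-mono h (eq-hyp m)  = eq-hyp (h m)
  eqCons-mono h (eq-refl t) = eq-refl t
  eqCons-mono h (eq-repl {s} {r} {a} {b} e f) =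
    eq-repl {s = s} {r} {a} {b} (eqCons-mono h e) (eqCons-mono h f)

  atomCons-mono : ∀ {Θ Θ' A} → Atoms⊆ Θ Θ' → AtomCons Θ A → AtomCons Θ' A
  atomCons-mono h (at-eq e)  = at-eq (eqCons-mono (atoms⇒eqs h) e)
  atomCons-mono h (at-hyp m) = at-hyp (h (atPred _ _) m)
  atomCons-mono h (at-repl {s} {r} {p} {ts} e c) =
    at-repl {s = s} {r} {p} {ts} (eqCons-mono (atoms⇒eqs h) e) (atomCons-mono h c)

  eqCons-shift : ∀ {Θ A} → EqCons Θ A → EqCons (map shift Θ) (shift A)
  eqCons-shift (eq-hyp m)  = eq-hyp (∈-map⁺ shift m)
  eqCons-shift (eq-refl t) = eq-refl (shiftT t)
  eqCons-shift {Θ} (eq-repl {s} {r} {a} {b} e f) =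
    subst (EqCons (map shift Θ)) (sym (shift-inst≐ r a b))
      (eq-repl {s = shiftT s} {shiftT r} {subT (exts up) a} {subT (exts up) b} (eqCons-shift e)
        (subst (EqCons (map shift Θ)) (shift-inst≐ s a b) (eqCons-shift f)))

  atomCons-shift : ∀ {Θ A} → AtomCons Θ A → AtomCons (map shift Θ) (shift A)
  atomCons-shift (at-eq e)  = at-eq (eqCons-shift e)
  atomCons-shift (at-hyp m) = at-hyp (∈-map⁺ shift m)
  atomCons-shift {Θ} (at-repl {s} {r} {p} {ts} e c) =
    subst (AtomCons (map shift Θ)) (sym (shift-instPred r p ts))
      (at-repl {s = shiftT s} {shiftT r} {p} {subTs (exts up) ts} (eqCons-shift e)
        (subst (AtomCons (map shift Θ)) (shift-instPred s p ts) (atomCons-shift c)))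

  module _ {L : Logic} where

    -- Repl⁻ for the atom t = v: rewrite the right-hand side of an equation.
    replRhs⁻ : ∀ {s r t Γ Δ} → G3[ L , minus ] (s ≐ r) ∷ (t ≐ r) ∷ Γ ⇒ Δ
             → G3[ L , minus ] (s ≐ r) ∷ (t ≐ s) ∷ Γ ⇒ Δ
    replRhs⁻ {s} {r} {t} {Γ} {Δ} d =
      subst (λ u → G3[ L , minus ] (s ≐ r) ∷ (u ≐ s) ∷ Γ ⇒ Δ) (inst-shiftT s t)
        (Repl⁻ {s = s} {r} {shiftT t ≐ var zero} ≡.refl (atEq _ _)
          (subst (λ u → G3[ L , minus ] (s ≐ r) ∷ (u ≐ r) ∷ Γ ⇒ Δ)
                 (sym (inst-shiftT r t)) d))

    -- Equations can be duplicated: Ref gives a = a, and Repl⁻ turns it,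
    -- using a = b, into a second copy of a = b.
    dupEq : ∀ {a b Ξ Δ} → (a ≐ b) ∈ Ξ → G3[ L , minus ] (a ≐ b) ∷ Ξ ⇒ Δ
          → G3[ L , minus ] Ξ ⇒ Δ
    dupEq {a} m d with extract m
    ... | Ξ₀ , Ξ↭ =
      perm (↭-sym Ξ↭) ↭-refl
        (Ref a (perm (swap _ _ ↭-refl) ↭-refl
          (replRhs⁻ (perm (prep _ Ξ↭) ↭-refl d))))

    assumeEq : ∀ {Θ Ξ Δ A} → EqCons Θ A → Eqs⊆ Θ Ξ
             → G3[ L , minus ] A ∷ Ξ ⇒ Δ → G3[ L , minus ] Ξ ⇒ Δ
    assumeEq (eq-hyp m)  h d = dupEq (h m) d
    assumeEq (eq-refl t) h d = Ref t d
    assumeEq (eq-repl {s} {r} {a} {b} e f) h d =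
      assumeEq f h (assumeEq e (λ m → there (h m))
        (Repl⁻ ≡.refl (atEq a b) (weaken d (s ≐ r))))

    -- An atomic consequence of the context may be assumed, at the price of
    -- possibly losing the predicate atom it was rewritten from; all
    -- equations survive.
    assumeAtom : ∀ {Θ Ξ Δ A} → AtomCons Θ A → Atoms⊆ Θ Ξ
               → (∀ {Ξ'} → Eqs⊆ Θ Ξ' → G3[ L , minus ] A ∷ Ξ' ⇒ Δ)
               → G3[ L , minus ] Ξ ⇒ Δ
    assumeAtom (at-eq e) h k = assumeEq e (atoms⇒eqs h) (k (atoms⇒eqs h))
    assumeAtom (at-hyp m) h k with extract (h (atPred _ _) m)
    ... | Ξ₀ , Ξ↭ =
      perm (↭-sym Ξ↭) ↭-refl (k (λ m' → eqs-drop-pred Ξ↭ (atoms⇒eqs h m')))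
    assumeAtom (at-repl {s} {r} {p} {ts} e c) h k =
      assumeAtom c h λ h' →
        assumeEq e (λ m → there (h' m))
          (Repl⁻ ≡.refl (atPred p ts)
            (perm (swap _ _ ↭-refl) ↭-refl (k (λ m → there (h' m)))))

  data Reduct (Θ : List Formula) : List Formula → List Formula → Set where
    []      : Reduct Θ [] []
    derived : ∀ {A Γ R} → AtomCons Θ A → Reduct Θ Γ R → Reduct Θ (A ∷ Γ) R
    kept    : ∀ {A Γ R} → Reduct Θ Γ R → Reduct Θ (A ∷ Γ) (A ∷ R)

  reduct-refl : ∀ {Θ} Γ → Reduct Θ Γ Γ
  reduct-refl []      = []
  reduct-refl (A ∷ Γ) = kept (reduct-refl Γ)

  reduct-mono : ∀ {Θ Θ' Γ R} → Atoms⊆ Θ Θ' → Reduct Θ Γ R → Reduct Θ' Γ R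
  reduct-mono h []            = []
  reduct-mono h (derived c r) = derived (atomCons-mono h c) (reduct-mono h r)
  reduct-mono h (kept r)      = kept (reduct-mono h r)

  reduct-shift : ∀ {Θ Γ R} → Reduct Θ Γ R
               → Reduct (map shift Θ) (map shift Γ) (map shift R)
  reduct-shift []            = []
  reduct-shift (derived c r) = derived (atomCons-shift c) (reduct-shift r)
  reduct-shift (kept r)      = kept (reduct-shift r)

  reduct-perm : ∀ {Θ Γ Γ' R} → Γ ↭ Γ' → Reduct Θ Γ R
              → ∃ λ R' → R ↭ R' × Reduct Θ Γ' R'
  reduct-perm ↭-refl r = _ , ↭-refl , r
  reduct-perm (prep x p) (derived c r) with reduct-perm p r
  ... | R' , q , r' = R' , q , derived c r'
  reduct-perm (prep x p) (kept r) with reduct-perm p r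
  ... | R' , q , r' = x ∷ R' , prep x q , kept r'
  reduct-perm (swap x y p) (derived cx (derived cy r)) with reduct-perm p r
  ... | R' , q , r' = R' , q , derived cy (derived cx r')
  reduct-perm (swap x y p) (derived cx (kept r)) with reduct-perm p r
  ... | R' , q , r' = y ∷ R' , prep y q , kept (derived cx r')
  reduct-perm (swap x y p) (kept (derived cy r)) with reduct-perm p r
  ... | R' , q , r' = x ∷ R' , prep x q , derived cy (kept r')
  reduct-perm (swap x y p) (kept (kept r)) with reduct-perm p r
  ... | R' , q , r' = y ∷ x ∷ R' , swap x y q , kept (kept r')
  reduct-perm (↭-trans p p') r with reduct-perm p r
  ... | R' , q , r' with reduct-perm p' r'
  ... | R'' , q' , r'' = R'' , ↭-trans q q' , r''

  reduct-insert : ∀ {Θ Γ R A} Γ₀ → AtomCons Θ A → Reduct Θ (Γ₀ ++ Γ) R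
                → Reduct Θ (Γ₀ ++ A ∷ Γ) R
  reduct-insert []       c r             = derived c r
  reduct-insert (_ ∷ Γ₀) c (derived c' r) = derived c' (reduct-insert Γ₀ c r)
  reduct-insert (_ ∷ Γ₀) c (kept r)       = kept (reduct-insert Γ₀ c r)

  reduct-atom : ∀ {Θ Γ R A} → Reduct Θ Γ R → (∀ {x} → x ∈ R → x ∈ Θ)
              → IsAtom A → A ∈ Γ → AtomCons Θ A
  reduct-atom (derived c r) R⊆ a (here ≡.refl) = c
  reduct-atom (derived c r) R⊆ a (there m)     = reduct-atom r R⊆ a m
  reduct-atom (kept r)      R⊆ a (here ≡.refl) = atomCons-hyp a (R⊆ (here ≡.refl))
  reduct-atom (kept r)      R⊆ a (there m)     = reduct-atom r (λ m' → R⊆ (there m')) a m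

  -- Logical rules are copied
  -- (a non-atomic principal formula is never omitted); Repl only records
  -- one more omitted atom; initial sequents rebuild their atom by assumeAtom.
  simulate : ∀ {L Γ Δ Θ} → G3[ L , full ] Γ ⇒ Δ → Reduct Θ Γ Θ
           → G3[ L , minus ] Θ ⇒ Δ
  simulate (perm p q d) r with reduct-perm (↭-sym p) r
  ... | _ , Θ↭ , r' = perm (↭-sym Θ↭) q (simulate d (reduct-mono (atoms-perm Θ↭) r'))
  simulate (ax a) r =
    assumeAtom (reduct-atom r (λ m → m) a (here ≡.refl)) (λ _ m → m) (λ _ → ax a)
  simulate ax⊥ (derived () r)
  simulate ax⊥ (kept r) = ax⊥
  simulate (L⊥ h) (derived () r)
  simulate (L⊥ h) (kept r) = L⊥ h
  simulate (L∧ d) (derived () r)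
  simulate (L∧ d) (kept r) =
    L∧ (simulate d (kept (kept (reduct-mono (atoms-drop (_ ∷ _ ∷ []) (λ ())) r))))
  simulate (R∧ d e) r = R∧ (simulate d r) (simulate e r)
  simulate (L∨ d e) (derived () r)
  simulate (L∨ d e) (kept r) =
    L∨ (simulate d (kept (reduct-mono (atoms-drop (_ ∷ []) (λ ())) r)))
       (simulate e (kept (reduct-mono (atoms-drop (_ ∷ []) (λ ())) r)))
  simulate (R∨ d) r = R∨ (simulate d r)
  simulate (L⊃c c d e) (derived () r)
  simulate (L⊃c c d e) (kept r) =
    L⊃c c (simulate d (reduct-mono (atoms-drop [] (λ ())) r))
          (simulate e (kept (reduct-mono (atoms-drop (_ ∷ []) (λ ())) r)))
  simulate (R⊃c c d) r = R⊃c c (simulate d (kept (reduct-mono atoms-extend r)))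
  simulate (L⊃i c d e) (derived () r)
  simulate (L⊃i c d e) (kept r) =
    L⊃i c (simulate d (kept r))
          (simulate e (kept (reduct-mono (atoms-drop (_ ∷ []) (λ ())) r)))
  simulate (R⊃i c d) r = R⊃i c (simulate d (kept (reduct-mono atoms-extend r)))
  simulate (L∀ t d) (derived () r)
  simulate (L∀ t d) (kept r) = L∀ t (simulate d (kept (kept (reduct-mono atoms-extend r))))
  simulate (R∀c c d) r = R∀c c (simulate d (reduct-shift r))
  simulate (R∀i c d) r = R∀i c (simulate d (reduct-shift r))
  simulate (L∃ d) (derived () r)
  simulate (L∃ d) (kept r) =
    L∃ (simulate d (kept (reduct-mono (atoms-drop (_ ∷ []) (λ ())) (reduct-shift r))))
  simulate (R∃ t d) r = R∃ t (simulate d r)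
  simulate (Ref t d) r = Ref t (simulate d (kept (reduct-mono atoms-extend r)))
  simulate (Repl {s} {r'} {P} _ a d) r =
    simulate d (reduct-insert (_ ∷ _ ∷ []) (atomCons-repl a s≐r Ps) r)
    where
      s≐r : AtomCons _ (s ≐ r')
      s≐r = reduct-atom r (λ m → m) (atEq s r') (here ≡.refl)
      Ps : AtomCons _ (inst P s)
      Ps = reduct-atom r (λ m → m) (inst-atom a) (there (here ≡.refl))
  simulate (Repl⁻ () a d) r

  full⇒minus : ∀ {L Γ Δ} → G3[ L , full ] Γ ⇒ Δ → G3[ L , minus ] Γ ⇒ Δ
  full⇒minus {Γ = Γ} d = simulate d (reduct-refl Γ)

theorem1 : (Σ : Signature) → let open Syntax Σ in
    (L : Logic) (Γ Δ : List Formula) →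
    (G3[ L , full ] Γ ⇒ Δ) ⇔ (G3[ L , minus ] Γ ⇒ Δ)
theorem1 Sg L Γ Δ = mk⇔ full⇒minus minus⇒full
  where open Proof Sg
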